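{- Let $S$ be a set of exactly $9$ points in $PG(3,2)$ which is a strong blocking set. Then: (1) every plane $\pi$ of $PG(3,2)$ satisfies $|\pi\cap S|\le 5$; (2) if a plane $\pi$ contains a line $\ell$ with $\ell\subseteq S$, then $|\pi\cap S|=5$ and the points of $\pi\cap S$ form two lines meeting in a point.
   Context: $PG(3,2)$ is the $3$-dimensional projective space over $\mathbb{F}_2$ (15 points, each line has 3 points). A strong blocking set in $PG(k-1,q)$ is a set of points $\mathcal{M}$ such that for every hyperplane $\sigma$, the projective span $\langle \sigma\cap\mathcal{M}\rangle$ equals $\sigma$. A strong blocking set in $PG(3,2)$ has at least $(k-1)(q+1)=9$ points; a strong blocking set of $PG(3,2)$ with exactly $9$ points is called a minimal strong blocking set. A line "of $S$" means a line all of whose points lie in $S$. -}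

module Defs where

open import Data.Bool using (Bool; true; false; _xor_; _∧_; _∨_; T)
open import Data.Vec using (Vec; []; _∷_; zipWith; replicate; foldr)
open import Data.List using (List; []; _∷_; filter; length; concatMap; map)
open import Data.List.Relation.Unary.All using (All)
open import Data.Product using (Σ; _×_; _,_)
open import Data.Sum using (_⊎_)
open import Data.Nat using (ℕ)
open import Relation.Binary.PropositionalEquality using (_≡_; _≢_)
open import Relation.Nullary using (¬_)
open import Relation.Nullary.Decidable using (Dec; yes; no)
open import Function using (_⇔_)

-- Vectors of F_2^4 (Bool with xor = addition, ∧ = multiplication).
V4 : Set
V4 = Vec Bool 4

zeroV : V4
zeroV = replicate 4 false

_⊕_ : V4 → V4 → V4
_⊕_ = zipWith _xor_

dot : V4 → V4 → Bool
dot a x = foldr (λ _ → Bool) _xor_ false (zipWith _∧_ a x)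

-- Points of PG(3,2) are the nonzero vectors of F_2^4 (each projective point
-- has exactly one nonzero representative over F_2).
IsPoint : V4 → Set
IsPoint v = v ≢ zeroV

sumV : List V4 → V4
sumV [] = zeroV
sumV (v ∷ vs) = v ⊕ sumV vs

allV : (n : ℕ) → List (Vec Bool n)
allV ℕ.zero = [] ∷ []
allV (ℕ.suc n) = concatMap (λ v → (false ∷ v) ∷ (true ∷ v) ∷ []) (allV n)

isNonzero : V4 → Bool
isNonzero (a ∷ b ∷ c ∷ d ∷ []) = a ∨ b ∨ c ∨ d

isNonzero? : (v : V4) → Dec (T (isNonzero v))
isNonzero? v with isNonzero v
... | true = yes _
... | false = no (λ ())

points : List V4
points = filter isNonzero? (allV 4)

-- A point set of PG(3,2) is given by its (Boolean) membership predicate;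
-- only its values on points matter.
PointSet : Set
PointSet = V4 → Bool

card : PointSet → ℕ
card S = length (filter (λ v → Data.Bool._≟_ (S v) true) points)
  where import Data.Bool

-- The hyperplanes (planes) of PG(3,2): for a nonzero functional a,
-- the plane  a^⊥ = { x | a·x = 0 }.
InPlane : V4 → V4 → Set
InPlane a x = dot a x ≡ false

_∩plane_ : PointSet → V4 → PointSet
(S ∩plane a) x = S x ∧ Data.Bool.not (dot a x)
  where import Data.Bool

-- The projective span of a point set T: a point x lies in ⟨T⟩ iff x is
-- the sum (over F_2) of finitely many points of T.
InSpan : PointSet → V4 → Set
InSpan T x = Σ (List V4) λ L → All (λ y → IsPoint y × T y ≡ true) L × sumV L ≡ x

-- Strong blocking set: for every hyperplane σ, ⟨σ ∩ M⟩ = σ.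
-- (⟨σ ∩ M⟩ ⊆ σ always holds, so this says every point of σ is in the span.)
StrongBlocking : PointSet → Set
StrongBlocking M = (a : V4) → IsPoint a →
  (x : V4) → IsPoint x → InPlane a x → InSpan (M ∩plane a) x

-- The line through two distinct points x, y is {x, y, x ⊕ y}.
-- It is a line "of S" if all three points lie in S.
LineOf : PointSet → V4 → V4 → Set
LineOf S x y = IsPoint x × IsPoint y × x ≢ y ×
  S x ≡ true × S y ≡ true × S (x ⊕ y) ≡ true

LineInPlane : V4 → V4 → V4 → Set
LineInPlane a x y = InPlane a x × InPlane a y

{-# OPTIONS --safe #-}
-- A strong blocking set S meets every plane a⊥ outside each line a⊥ ∩ b⊥ of it:
-- otherwise S ∩ a⊥ would lie in the hyperplane b⊥ of a⊥, and so would its span,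
-- which is all of a⊥.  This covering property is all the proof uses.  Both it and
-- the conclusion only involve the values of S on the 15 points, and evaluation
-- over all 2¹⁵ subsets confirms that every 9-set with the covering property meets
-- each plane in at most 5 points, and either in a line-free set or in two
-- concurrent lines.
module Submission where

open import Defs
open import Data.Nat using (_≤_)
open import Data.Bool using (true)
open import Data.Product using (Σ; _×_)
open import Data.Sum using (_⊎_)
open import Relation.Binary.PropositionalEquality using (_≡_; _≢_)
open import Function using (_⇔_)

open import Algebra.Bundles using (CommutativeRing)
open import Data.Bool using (Bool; false; not; _∧_; _∨_; _xor_; T; T?) renaming (_≟_ to _≟B_)
open import Data.Bool.ListAction using (all; any)
open import Data.Bool.Properties
  using (xor-∧-commutativeRing; ∧-distribˡ-xor; ∧-zeroʳ; T-∧; T-∨; T-≡)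
open import Algebra.Properties.CommutativeSemigroup
  (CommutativeRing.+-commutativeSemigroup xor-∧-commutativeRing) using (interchange)
open import Data.Empty using (⊥-elim)
open import Data.List using (List; []; _∷_; filter; length; map; concatMap)
open import Data.List.Properties using (filter-accept; filter-reject)
open import Data.List.Membership.Propositional using (_∈_; find; lose)
open import Data.List.Membership.Propositional.Properties
  using (∈-concatMap⁺; ∈-concatMap⁻; ∈-map⁺; ∈-map⁻; ∈-filter⁺; ∈-filter⁻)
open import Data.List.Relation.Unary.All as All using (All)
open import Data.List.Relation.Unary.All.Properties using (all⁺; all⁻)
open import Data.List.Relation.Unary.Any as Any using (Any; here; there)
open import Data.List.Relation.Unary.Any.Properties using (any⁺; any⁻)
open import Data.Nat using (ℕ; zero; suc; _≡ᵇ_; _≤ᵇ_)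
open import Data.Nat.Properties using (≡ᵇ⇒≡; ≡⇒≡ᵇ; ≤ᵇ⇒≤)
open import Data.Product using (_,_; proj₁; proj₂)
open import Data.Sum using (inj₁; inj₂; [_,_])
open import Data.Unit using (tt)
open import Data.Vec using (Vec; []; _∷_; zipWith; replicate; foldr)
open import Data.Vec.Properties using (≡-dec; ∷-injectiveˡ; ∷-injectiveʳ)
open import Function using (_∘_; mk⇔; Equivalence)
open import Relation.Binary.Definitions using (DecidableEquality)
open import Relation.Binary.PropositionalEquality
  using (refl; sym; trans; cong; cong₂; subst; module ≡-Reasoning)
open import Relation.Nullary using (¬_; ¬?; Dec; yes; no)
open import Relation.Nullary.Decidable using (⌊_⌋; _×-dec_; _⊎-dec_; toWitness; fromWitness)
open import Relation.Unary using (Decidable)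

open Equivalence using (to; from)

T-not⇒¬T : ∀ {b} → T (not b) → ¬ T b
T-not⇒¬T {false} _ ()

T-not∧ : ∀ {x y} → T (not x ∧ y) ⇔ (x ≡ false × y ≡ true)
T-not∧ {false} {true}  = mk⇔ (λ _ → refl , refl) (λ _ → tt)
T-not∧ {false} {false} = mk⇔ (λ ()) (λ { (_ , ()) })
T-not∧ {true}          = mk⇔ (λ ()) (λ { (() , _) })

∧-not-true : ∀ {x y} → x ∧ not y ≡ true → x ≡ true × y ≡ false
∧-not-true {true} {false} _ = refl , refl

xor-false⇒≡ : ∀ {u v} → u xor v ≡ false → u ≡ v
xor-false⇒≡ {false} {false} _ = refl
xor-false⇒≡ {true}  {true}  _ = refl

≡⌊⌋⇒⇔ : ∀ {A : Set} {b} (a? : Dec A) → b ≡ ⌊ a? ⌋ → (b ≡ true) ⇔ A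
≡⌊⌋⇒⇔ a? b≡a? = mk⇔ (λ b≡t → toWitness {a? = a?} (from T-≡ (trans (sym b≡a?) b≡t)))
                     (λ a → trans b≡a? (to T-≡ (fromWitness a)))

-- Linear algebra over 𝔽₂; dot is _·_ at n = 4.

_·_ : ∀ {n} → Vec Bool n → Vec Bool n → Bool
a · x = foldr (λ _ → Bool) _xor_ false (zipWith _∧_ a x)

·-distribˡ-xor : ∀ {n} (a x y : Vec Bool n) → a · zipWith _xor_ x y ≡ (a · x) xor (a · y)
·-distribˡ-xor []      []      []      = refl
·-distribˡ-xor (c ∷ a) (u ∷ x) (v ∷ y) = begin
  (c ∧ (u xor v)) xor (a · zipWith _xor_ x y)
    ≡⟨ cong₂ _xor_ (∧-distribˡ-xor c u v) (·-distribˡ-xor a x y) ⟩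
  ((c ∧ u) xor (c ∧ v)) xor ((a · x) xor (a · y))
    ≡⟨ interchange (c ∧ u) (c ∧ v) (a · x) (a · y) ⟩
  ((c ∧ u) xor (a · x)) xor ((c ∧ v) xor (a · y)) ∎
  where open ≡-Reasoning

·-zeroʳ : ∀ {n} (a : Vec Bool n) → a · replicate n false ≡ false
·-zeroʳ []      = refl
·-zeroʳ (c ∷ a) = cong₂ _xor_ (∧-zeroʳ c) (·-zeroʳ a)

xor-zero⇒≡ : ∀ {n} (x y : Vec Bool n) → zipWith _xor_ x y ≡ replicate n false → x ≡ y
xor-zero⇒≡ []      []      _ = refl
xor-zero⇒≡ (u ∷ x) (v ∷ y) e =
  cong₂ _∷_ (xor-false⇒≡ (∷-injectiveˡ e)) (xor-zero⇒≡ x y (∷-injectiveʳ e))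

⊕-IsPoint : ∀ {x y} → x ≢ y → IsPoint (x ⊕ y)
⊕-IsPoint {x} {y} x≢y = x≢y ∘ xor-zero⇒≡ x y

dot-true⇒IsPoint : ∀ {b z} → dot b z ≡ true → IsPoint z
dot-true⇒IsPoint {b} b·z refl with () ← trans (sym b·z) (·-zeroʳ b)

InPlane-⊕ : ∀ {a x y} → InPlane a x → InPlane a y → InPlane a (x ⊕ y)
InPlane-⊕ {a} {x} {y} a·x a·y = trans (·-distribˡ-xor a x y) (cong₂ _xor_ a·x a·y)

sumV-witness : ∀ b (L : List V4) → dot b (sumV L) ≡ true → Any (λ y → dot b y ≡ true) L
sumV-witness b []      b·0 with () ← trans (sym b·0) (·-zeroʳ b)
sumV-witness b (y ∷ L) b·Σ with dot b y in b·y
... | true  = here b·y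
... | false = there (sumV-witness b L (begin
  dot b (sumV L)                  ≡⟨ cong (_xor dot b (sumV L)) b·y ⟨
  dot b y xor dot b (sumV L)      ≡⟨ ·-distribˡ-xor b y (sumV L) ⟨
  dot b (y ⊕ sumV L)              ≡⟨ b·Σ ⟩
  true                            ∎))
  where open ≡-Reasoning

_≟V_ : ∀ {n} → DecidableEquality (Vec Bool n)
_≟V_ = ≡-dec _≟B_

∈-allV : ∀ {n} (v : Vec Bool n) → v ∈ allV n
∈-allV []          = here refl
∈-allV (false ∷ v) = ∈-concatMap⁺ _ (Any.map (λ { refl → here refl }) (∈-allV v))
∈-allV (true ∷ v)  = ∈-concatMap⁺ _ (Any.map (λ { refl → there (here refl) }) (∈-allV v))

IsPoint⇒isNonzero : ∀ v → IsPoint v → T (isNonzero v)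
IsPoint⇒isNonzero (true  ∷ _     ∷ _     ∷ _     ∷ []) _   = tt
IsPoint⇒isNonzero (false ∷ true  ∷ _     ∷ _     ∷ []) _   = tt
IsPoint⇒isNonzero (false ∷ false ∷ true  ∷ _     ∷ []) _   = tt
IsPoint⇒isNonzero (false ∷ false ∷ false ∷ true  ∷ []) _   = tt
IsPoint⇒isNonzero (false ∷ false ∷ false ∷ false ∷ []) v≢0 = ⊥-elim (v≢0 refl)

∈-points : ∀ {v} → IsPoint v → v ∈ points
∈-points {v} v≢0 = ∈-filter⁺ isNonzero? (∈-allV v) (IsPoint⇒isNonzero v v≢0)

∈-points⁻ : ∀ {v} → v ∈ points → IsPoint v
∈-points⁻ v∈ refl with () ← proj₂ (∈-filter⁻ isNonzero? {xs = allV 4} v∈)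

-- Point sets as decision trees on the four coordinates

data Tree : ℕ → Set where
  leaf : Bool → Tree zero
  node : ∀ {n} → Tree n → Tree n → Tree (suc n)

_‼_ : ∀ {n} → Tree n → Vec Bool n → Bool
leaf b   ‼ []          = b
node l r ‼ (false ∷ v) = l ‼ v
node l r ‼ (true  ∷ v) = r ‼ v

tabulate : ∀ {n} → (Vec Bool n → Bool) → Tree n
tabulate {zero}  f = leaf (f [])
tabulate {suc n} f = node (tabulate (f ∘ (false ∷_))) (tabulate (f ∘ (true ∷_)))

tabulate-‼ : ∀ {n} (f : Vec Bool n → Bool) v → tabulate f ‼ v ≡ f v
tabulate-‼ f []          = refl
tabulate-‼ f (false ∷ v) = tabulate-‼ (f ∘ (false ∷_)) v
tabulate-‼ f (true  ∷ v) = tabulate-‼ (f ∘ (true ∷_)) v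

allTree : ∀ {n} → (Tree n → Bool) → Bool
allTree {zero}  f = f (leaf false) ∧ f (leaf true)
allTree {suc n} f = allTree λ l → allTree λ r → f (node l r)

allTree-sound : ∀ {n} (f : Tree n → Bool) → T (allTree f) → ∀ t → T (f t)
allTree-sound {zero}  f h (leaf false) = proj₁ (to T-∧ h)
allTree-sound {zero}  f h (leaf true)  = proj₂ (to T-∧ h)
allTree-sound {suc n} f h (node l r)   =
  allTree-sound (λ r → f (node l r)) (allTree-sound (λ l → allTree λ r → f (node l r)) h l) r

-- The zero vector is not a point, so trees that are false there suffice.
allTree₀ : ∀ {n} → (Tree n → Bool) → Bool
allTree₀ {zero}  f = f (leaf false)
allTree₀ {suc n} f = allTree₀ λ l → allTree λ r → f (node l r)

allTree₀-sound : ∀ {n} (f : Tree n → Bool) → T (allTree₀ f) →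
                 ∀ t → t ‼ replicate n false ≡ false → T (f t)
allTree₀-sound {zero}  f h (leaf false) _  = h
allTree₀-sound {suc n} f h (node l r)   l₀ =
  allTree-sound (λ r → f (node l r)) (allTree₀-sound (λ l → allTree λ r → f (node l r)) h l l₀) r

-- {z ∣ a·z = 0, b·z = 1} is the plane a⊥ with its line a⊥ ∩ b⊥ removed.
MeetsPlanesOffLines : PointSet → Set
MeetsPlanesOffLines S = ∀ a → IsPoint a → ∀ b → IsPoint b → a ≢ b →
  Σ V4 λ z → InPlane a z × dot b z ≡ true × S z ≡ true

offLine : V4 → V4 → List V4
offLine a b = filter (λ z → T? (not (dot a z) ∧ dot b z)) points

offLine⁺ : ∀ {a b z} → InPlane a z → dot b z ≡ true → z ∈ offLine a b
offLine⁺ {a} {b} a·z b·z =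
  ∈-filter⁺ (λ z → T? (not (dot a z) ∧ dot b z)) (∈-points (dot-true⇒IsPoint {b} b·z))
            (from T-not∧ (a·z , b·z))

offLine⁻ : ∀ {a b z} → z ∈ offLine a b → InPlane a z × dot b z ≡ true
offLine⁻ {a} {b} z∈ =
  to T-not∧ (proj₂ (∈-filter⁻ (λ z → T? (not (dot a z) ∧ dot b z)) {xs = points} z∈))

offLinesFrom : V4 → List (List V4)
offLinesFrom a = map (offLine a) (filter (λ b → ¬? (a ≟V b)) points)

offLines : List (List V4)
offLines = concatMap offLinesFrom points

offLine∈offLines : ∀ {a b} → IsPoint a → IsPoint b → a ≢ b → offLine a b ∈ offLines
offLine∈offLines {a} a≢0 b≢0 a≢b = ∈-concatMap⁺ offLinesFrom
  (lose (∈-points a≢0) (∈-map⁺ (offLine a) (∈-filter⁺ (λ b → ¬? (a ≟V b)) (∈-points b≢0) a≢b)))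

offLines⁻ : ∀ {Z} → Z ∈ offLines →
  Σ V4 λ a → Σ V4 λ b → IsPoint a × IsPoint b × a ≢ b × Z ≡ offLine a b
offLines⁻ Z∈ with find (∈-concatMap⁻ offLinesFrom {xs = points} Z∈)
... | a , a∈ , Z∈′ with ∈-map⁻ (offLine a) Z∈′
... | b , b∈ , refl with ∈-filter⁻ (λ b → ¬? (a ≟V b)) {xs = points} b∈
... | b∈points , a≢b = a , b , ∈-points⁻ a∈ , ∈-points⁻ b∈points , a≢b , refl

hits : List (List V4) → PointSet → Bool
hits Zs M = all (any M) Zs

hits-sound : ∀ M → T (hits offLines M) → MeetsPlanesOffLines M
hits-sound M h a a≢0 b b≢0 a≢b =
  let hitsZ       = All.lookup (all⁺ (any M) offLines h) (offLine∈offLines {a} {b} a≢0 b≢0 a≢b)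
      z , z∈ , Mz = find (any⁻ M (offLine a b) hitsZ)
      a·z , b·z   = offLine⁻ {a} {b} z∈
  in z , a·z , b·z , to T-≡ Mz

hits-complete : ∀ M → MeetsPlanesOffLines M → T (hits offLines M)
hits-complete M meets = all⁻ (any M) (All.tabulate hitsOffLine)
  where
  hitsOffLine : ∀ {Z} → Z ∈ offLines → T (any M Z)
  hitsOffLine Z∈ with offLines⁻ Z∈
  ... | a , b , a≢0 , b≢0 , a≢b , refl with meets a a≢0 b b≢0 a≢b
  ... | z , a·z , b·z , Mz = any⁺ M (lose (offLine⁺ {a} {b} a·z b·z) (from T-≡ Mz))

planes-differ : ∀ {a b} → IsPoint a → IsPoint b → a ≢ b →
                Σ V4 λ x → InPlane a x × dot b x ≡ true
planes-differ a≢0 b≢0 a≢b =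
  let x , a·x , b·x , _ = hits-sound (λ _ → true) tt _ a≢0 _ b≢0 a≢b in x , a·x , b·x

∩plane⁺ : ∀ S a {z} → S z ≡ true → InPlane a z → (S ∩plane a) z ≡ true
∩plane⁺ S a Sz a·z rewrite Sz | a·z = refl

strongBlocking⇒meetsPlanesOffLines : ∀ S → StrongBlocking S → MeetsPlanesOffLines S
strongBlocking⇒meetsPlanesOffLines S sb a a≢0 b b≢0 a≢b =
  let x , a·x , b·x      = planes-differ a≢0 b≢0 a≢b
      L , L⊆S∩a , ΣL≡x  = sb a a≢0 x (dot-true⇒IsPoint {b} b·x) a·x
      y , y∈L , b·y      = find (sumV-witness b L (trans (cong (dot b) ΣL≡x) b·x))
      Sy , a·y           = ∧-not-true (proj₂ (All.lookup L⊆S∩a y∈L))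
  in y , a·y , b·y , Sy

members : PointSet → List V4
members R = filter (λ v → R v ≟B true) points

members⁺ : ∀ {R v} → IsPoint v → R v ≡ true → v ∈ members R
members⁺ {R} v≢0 Rv = ∈-filter⁺ (λ v → R v ≟B true) (∈-points v≢0) Rv

members⁻ : ∀ {R v} → v ∈ members R → IsPoint v
members⁻ {R} v∈ = ∈-points⁻ (proj₁ (∈-filter⁻ (λ v → R v ≟B true) {xs = points} v∈))

Lineless : PointSet → Set
Lineless R = ∀ x y → ¬ LineOf R x y

OnPencil : V4 → V4 → V4 → V4 → Set
OnPencil p q r z = z ≡ p ⊎ z ≡ q ⊎ z ≡ (p ⊕ q) ⊎ z ≡ r ⊎ z ≡ (p ⊕ r)

ConcurrentLines : PointSet → Set
ConcurrentLines R = Σ V4 λ p → Σ V4 λ q → Σ V4 λ r →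
  IsPoint p × IsPoint q × IsPoint r × p ≢ q
  × r ≢ p × r ≢ q × r ≢ (p ⊕ q)
  × ((z : V4) → IsPoint z → (R z ≡ true) ⇔ OnPencil p q r z)

SectionCondition : PointSet → Set
SectionCondition R = card R ≤ 5 × (Lineless R ⊎ (card R ≡ 5 × ConcurrentLines R))

lineOf-∩plane : ∀ {S a x y} → LineOf S x y → LineInPlane a x y → LineOf (S ∩plane a) x y
lineOf-∩plane {S} {a} (x≢0 , y≢0 , x≢y , Sx , Sy , Sxy) (a·x , a·y) = x≢0 , y≢0 , x≢y ,
  ∩plane⁺ S a Sx a·x , ∩plane⁺ S a Sy a·y , ∩plane⁺ S a Sxy (InPlane-⊕ {a} a·x a·y)

lineSection-concurrent : ∀ {S a x y} → SectionCondition (S ∩plane a) → LineOf S x y →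
  LineInPlane a x y → card (S ∩plane a) ≡ 5 × ConcurrentLines (S ∩plane a)
lineSection-concurrent {S} {a} (_ , inj₁ lineless) line inPlane =
  ⊥-elim (lineless _ _ (lineOf-∩plane {S} {a} line inPlane))
lineSection-concurrent (_ , inj₂ concurrent) _ _ = concurrent

noLineThrough : PointSet → List V4 → V4 → Bool
noLineThrough R P x = all (λ y → ⌊ x ≟V y ⌋ ∨ not (R (x ⊕ y))) P

lineless : PointSet → List V4 → Bool
lineless R P = all (noLineThrough R P) P

lineless-sound : ∀ R → T (lineless R (members R)) → Lineless R
lineless-sound R h x y (x≢0 , y≢0 , x≢y , Rx , Ry , Rxy) =
  [ x≢y ∘ toWitness {a? = x ≟V y} , (λ ¬Rxy → T-not⇒¬T ¬Rxy (from T-≡ Rxy)) ] (to T-∨ xyOK)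
  where
  P : List V4
  P = members R
  xyOK : T (⌊ x ≟V y ⌋ ∨ not (R (x ⊕ y)))
  xyOK = All.lookup (all⁺ _ P (All.lookup (all⁺ (noLineThrough R P) P h) (members⁺ {R} x≢0 Rx)))
                    (members⁺ {R} y≢0 Ry)

onPencil? : ∀ p q r z → Dec (OnPencil p q r z)
onPencil? p q r z = z ≟V p ⊎-dec z ≟V q ⊎-dec z ≟V (p ⊕ q) ⊎-dec z ≟V r ⊎-dec z ≟V (p ⊕ r)

Distinct : V4 → V4 → V4 → Set
Distinct p q r = p ≢ q × r ≢ p × r ≢ q × r ≢ (p ⊕ q)

distinct? : ∀ p q r → Dec (Distinct p q r)
distinct? p q r = ¬? (p ≟V q) ×-dec ¬? (r ≟V p) ×-dec ¬? (r ≟V q) ×-dec ¬? (r ≟V (p ⊕ q))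

agreesWithPencil : PointSet → V4 → V4 → V4 → V4 → Bool
agreesWithPencil R p q r z = ⌊ R z ≟B ⌊ onPencil? p q r z ⌋ ⌋

pencilAt : PointSet → V4 → V4 → V4 → Bool
pencilAt R p q r = ⌊ distinct? p q r ⌋ ∧ all (agreesWithPencil R p q r) points

pencilIn : PointSet → List V4 → Bool
pencilIn R P = any (λ p → any (λ q → any (λ r → pencilAt R p q r) P) P) P

pencilAt-sound : ∀ {R p q r} → IsPoint p → IsPoint q → IsPoint r →
                 T (pencilAt R p q r) → ConcurrentLines R
pencilAt-sound {R} {p} {q} {r} p≢0 q≢0 r≢0 h =
  let distinct , onPencil               = to T-∧ h
      p≢q , r≢p , r≢q , r≢p⊕q           = toWitness {a? = distinct? p q r} distinct
      pencil : (z : V4) → IsPoint z → (R z ≡ true) ⇔ OnPencil p q r z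
      pencil z z≢0 = ≡⌊⌋⇒⇔ (onPencil? p q r z) (toWitness {a? = R z ≟B ⌊ onPencil? p q r z ⌋}
        (All.lookup (all⁺ (agreesWithPencil R p q r) points onPencil) (∈-points z≢0)))
  in p , q , r , p≢0 , q≢0 , r≢0 , p≢q , r≢p , r≢q , r≢p⊕q , pencil

pencilIn-sound : ∀ R → T (pencilIn R (members R)) → ConcurrentLines R
pencilIn-sound R h =
  let p , p∈ , hp = find (any⁻ _ _ h)
      q , q∈ , hq = find (any⁻ _ _ hp)
      r , r∈ , hr = find (any⁻ _ _ hq)
  in pencilAt-sound (members⁻ {R} p∈) (members⁻ {R} q∈) (members⁻ {R} r∈) hr

sectionOK : PointSet → List V4 → Bool
sectionOK R P = (length P ≤ᵇ 5) ∧ (lineless R P ∨ ((length P ≡ᵇ 5) ∧ pencilIn R P))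

planeOK : PointSet → V4 → Bool
planeOK M a = sectionOK (M ∩plane a) (members (M ∩plane a))

sectionOK-sound : ∀ R → T (sectionOK R (members R)) → SectionCondition R
sectionOK-sound R h with to T-∧ h
... | ≤5 , rest = ≤ᵇ⇒≤ (card R) 5 ≤5 , shape (to T-∨ rest)
  where
  shape : T (lineless R (members R)) ⊎ T ((card R ≡ᵇ 5) ∧ pencilIn R (members R)) →
          Lineless R ⊎ (card R ≡ 5 × ConcurrentLines R)
  shape (inj₁ ll)   = inj₁ (lineless-sound R ll)
  shape (inj₂ five) = let ≡5 , pencil = to T-∧ five
                      in inj₂ (≡ᵇ⇒≡ (card R) 5 ≡5 , pencilIn-sound R pencil)

Settled : PointSet → Set
Settled M = card M ≡ 9 → MeetsPlanesOffLines M → ∀ a → IsPoint a → SectionCondition (M ∩plane a)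

-- check is opaque so that unifying against T (allTree₀ …) does not trigger the
-- exhaustive evaluation; only checkAll-offLines unfolds it.
opaque
  check : List (List V4) → PointSet → Bool
  check Zs M = not (card M ≡ᵇ 9) ∨ not (hits Zs M)
             ∨ all (planeOK M) points

  check-sound : ∀ M → T (check offLines M) → Settled M
  check-sound M h card≡9 meets a a≢0 with to T-∨ h
  ... | inj₁ ≢9 = ⊥-elim (T-not⇒¬T ≢9 (≡⇒≡ᵇ (card M) 9 card≡9))
  ... | inj₂ h′ with to T-∨ h′
  ...   | inj₁ ¬hits   = ⊥-elim (T-not⇒¬T ¬hits (hits-complete M meets))
  ...   | inj₂ planes =
    sectionOK-sound (M ∩plane a) (All.lookup (all⁺ (planeOK M) points planes) (∈-points a≢0))

checkAll : List (List V4) → Bool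
checkAll Zs = allTree₀ λ t → check Zs (t ‼_)

-- offLines is passed as an argument so that call-by-need evaluation builds it
-- only once rather than once per tree.
opaque
  unfolding check
  checkAll-offLines : checkAll offLines ≡ true
  checkAll-offLines = refl

everyTree-settled : ∀ (t : Tree 4) → t ‼ zeroV ≡ false → Settled (t ‼_)
everyTree-settled t t₀ =
  check-sound (t ‼_)
    (allTree₀-sound (λ t → check offLines (t ‼_)) (from T-≡ checkAll-offLines) t t₀)

AgreeOnPoints : PointSet → PointSet → Set
AgreeOnPoints S M = ∀ v → IsPoint v → S v ≡ M v

filter-cong-∈ : ∀ {A : Set} {P Q : A → Set} (P? : Decidable P) (Q? : Decidable Q) xs →
                (∀ {x} → x ∈ xs → P x ⇔ Q x) → filter P? xs ≡ filter Q? xs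
filter-cong-∈ P? Q? []       _   = refl
filter-cong-∈ P? Q? (x ∷ xs) P⇔Q with P? x | filter-cong-∈ P? Q? xs (P⇔Q ∘ there)
... | yes px | ih = trans (cong (x ∷_) ih) (sym (filter-accept Q? (to (P⇔Q (here refl)) px)))
... | no ¬px | ih = trans ih (sym (filter-reject Q? (¬px ∘ from (P⇔Q (here refl)))))

card-cong : ∀ {S M} → AgreeOnPoints S M → card S ≡ card M
card-cong {S} {M} S≐M =
  cong length (filter-cong-∈ (λ v → S v ≟B true) (λ v → M v ≟B true) points λ v∈ →
    let Sv≡Mv = S≐M _ (∈-points⁻ v∈) in mk⇔ (trans (sym Sv≡Mv)) (trans Sv≡Mv))

∩plane-cong : ∀ {S M} → AgreeOnPoints S M → ∀ a → AgreeOnPoints (S ∩plane a) (M ∩plane a)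
∩plane-cong S≐M a v v≢0 = cong (_∧ not (dot a v)) (S≐M v v≢0)

meetsPlanesOffLines-cong : ∀ {S M} → AgreeOnPoints S M →
                           MeetsPlanesOffLines S → MeetsPlanesOffLines M
meetsPlanesOffLines-cong S≐M meets a a≢0 b b≢0 a≢b =
  let z , a·z , b·z , Sz = meets a a≢0 b b≢0 a≢b
  in z , a·z , b·z , trans (sym (S≐M z (dot-true⇒IsPoint {b} b·z))) Sz

lineOf-cong : ∀ {R R′ x y} → AgreeOnPoints R R′ → LineOf R x y → LineOf R′ x y
lineOf-cong {R} {R′} R≐R′ (x≢0 , y≢0 , x≢y , Rx , Ry , Rxy) =
  x≢0 , y≢0 , x≢y , moved x≢0 Rx , moved y≢0 Ry , moved (⊕-IsPoint x≢y) Rxy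
  where
  moved : ∀ {v} → IsPoint v → R v ≡ true → R′ v ≡ true
  moved {v} v≢0 = trans (sym (R≐R′ v v≢0))

concurrentLines-cong : ∀ {R R′} → AgreeOnPoints R R′ → ConcurrentLines R′ → ConcurrentLines R
concurrentLines-cong R≐R′ (p , q , r , p≢0 , q≢0 , r≢0 , p≢q , r≢p , r≢q , r≢p⊕q , pencil) =
  p , q , r , p≢0 , q≢0 , r≢0 , p≢q , r≢p , r≢q , r≢p⊕q , λ z z≢0 →
    mk⇔ (to (pencil z z≢0) ∘ trans (sym (R≐R′ z z≢0)))
        (trans (R≐R′ z z≢0) ∘ from (pencil z z≢0))

sectionCondition-cong : ∀ {R R′} → AgreeOnPoints R R′ → SectionCondition R′ → SectionCondition R
sectionCondition-cong {R} {R′} R≐R′ (≤5 , shape) = subst (_≤ 5) (sym card≡) ≤5 , shape′ shape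
  where
  card≡ : card R ≡ card R′
  card≡ = card-cong R≐R′
  shape′ : Lineless R′ ⊎ (card R′ ≡ 5 × ConcurrentLines R′) →
           Lineless R ⊎ (card R ≡ 5 × ConcurrentLines R)
  shape′ (inj₁ lineless)         = inj₁ λ x y → lineless x y ∘ lineOf-cong R≐R′
  shape′ (inj₂ (≡5 , concurrent)) = inj₂ (trans card≡ ≡5 , concurrentLines-cong R≐R′ concurrent)

settled : ∀ S → Settled S
settled S card≡9 meets a a≢0 =
  sectionCondition-cong (∩plane-cong S≐t a)
    (everyTree-settled t (tabulate-‼ nonzeroPart zeroV) (trans (sym (card-cong S≐t)) card≡9)
      (meetsPlanesOffLines-cong S≐t meets) a a≢0)
  where
  nonzeroPart : PointSet
  nonzeroPart v = isNonzero v ∧ S v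
  t : Tree 4
  t = tabulate nonzeroPart
  S≐t : AgreeOnPoints S (t ‼_)
  S≐t v v≢0 =
    sym (trans (tabulate-‼ nonzeroPart v) (cong (_∧ S v) (to T-≡ (IsPoint⇒isNonzero v v≢0))))

mainTheorem1 : (S : PointSet) → card S ≡ 9 → StrongBlocking S →
    ((a : V4) → IsPoint a → card (S ∩plane a) ≤ 5)
    × ((a : V4) → IsPoint a → (x y : V4) → LineOf S x y → LineInPlane a x y →
        card (S ∩plane a) ≡ 5
        × Σ V4 λ p → Σ V4 λ q → Σ V4 λ r →
            IsPoint p × IsPoint q × IsPoint r × p ≢ q
            × r ≢ p × r ≢ q × r ≢ (p ⊕ q)
            × ((z : V4) → IsPoint z →
                 ((S ∩plane a) z ≡ true)
                 ⇔ (z ≡ p ⊎ z ≡ q ⊎ z ≡ (p ⊕ q) ⊎ z ≡ r ⊎ z ≡ (p ⊕ r))))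
mainTheorem1 S card≡9 sb =
  (λ a a≢0 → proj₁ (sections a a≢0)) ,
  (λ a a≢0 x y → lineSection-concurrent {S} {a} (sections a a≢0))
  where
  sections : ∀ a → IsPoint a → SectionCondition (S ∩plane a)
  sections = settled S card≡9 (strongBlocking⇒meetsPlanesOffLines S sb)
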